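{- Let $G$ be a finite directed graph and $C$ a cycle of $G$. Then $$\varphi(G)=\varphi(T_C(G)),\qquad\text{where}\qquad T_C(G)=\sum_{\substack{E'\subset HE(C)\\ E'\neq\emptyset}}(-1)^{|E'|-1}\, G\setminus E',$$ that is, $\varphi(G)=\sum_{\emptyset\neq E'\subset HE(C)}(-1)^{|E'|-1}\varphi(G\setminus E')$.
   Context: A graph $G$ consists of a finite vertex set $V_G$ and an edge set $E_G\subset V_G\times V_G$; for $e=(u,v)$ write $\alpha(e)=u$ (origin), $\omega(e)=v$ (end), and $\overline{e}=(v,u)$. A linear extension of $G$ is a total order $\le_w$ on $V_G$ such that $\alpha(e)\le_w\omega(e)$ for every $e\in E_G$; it is identified with the word $w$ listing the vertices in increasing order. $\mathcal L(G)$ denotes the set of linear extensions and $\varphi(G)=\sum_{w\in\mathcal L(G)}w$, an element of the free abelian group on words; $\varphi$ is extended linearly to formal $\mathbb Z$-linear combinations of graphs. A cycle of $G$ is a sequence $(e_1,\dots,e_k)$ of elements of $E_G\cup\{\overline e: e\in E_G\}$ with $\omega(e_i)=\alpha(e_{i+1})$ for $i<k$ and $\omega(e_k)=\alpha(e_1)$, all $e_i$ distinct and all vertices visited distinct; $HE(C)$ denotes the set of those $e_i$ that belong to $E_G$. For $E'\subset E_G$, $G\setminus E'$ is the graph with vertex set $V_G$ and edge set $E_G\setminus E'$. -}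

module Defs where

open import Data.Nat using (ℕ; zero; suc; _∸_)
open import Data.Fin using (Fin) renaming (_≟_ to _≟F_)
open import Data.Fin.Properties renaming (all? to allFin?)
open import Data.Bool using (Bool; true; false; if_then_else_)
open import Data.Product using (_×_; _,_; proj₁; proj₂; ∃; Σ)
open import Data.Product.Properties using (≡-dec)
open import Data.Sum using (_⊎_; inj₁; inj₂)
open import Data.List using (List; []; _∷_; _++_; [_]; map; filter; length; foldr)
open import Data.List.Relation.Unary.All using (All; all?)
open import Data.List.Relation.Unary.Unique.Propositional using (Unique)
open import Data.List.Membership.Propositional using (_∈_; _∉_)
open import Data.Integer using (ℤ; 0ℤ; 1ℤ; -1ℤ; _*_; _^_) renaming (_+_ to _+ℤ_)
open import Relation.Nullary using (Dec; yes; no; ¬_; does; ¬?; _×-dec_)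
open import Relation.Binary.PropositionalEquality using (_≡_; _≢_; refl)
open import Relation.Binary.Definitions using (DecidableEquality)
import Data.List.Membership.DecPropositional as DecMem
import Data.List.Relation.Unary.Unique.DecPropositional as DecUniq

-- Graphs on the vertex set V_G = Fin n.
-- The edge set E_G ⊆ V_G × V_G is given as a list of pairs (u , v);
-- the theorem assumes this list has no repetitions, so it is a set.

Edge : ℕ → Set
Edge n = Fin n × Fin n

Graph : ℕ → Set
Graph n = List (Edge n)

α ω : ∀ {n} → Edge n → Fin n
α = proj₁
ω = proj₂

rev : ∀ {n} → Edge n → Edge n
rev (u , v) = (v , u)

_≟E_ : ∀ {n} → DecidableEquality (Edge n)
_≟E_ = ≡-dec _≟F_ _≟F_

_∈E?_ : ∀ {n} (e : Edge n) (E : List (Edge n)) → Dec (e ∈ E)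
_∈E?_ {n} = DecMem._∈?_ (_≟E_ {n})

Word : ℕ → Set
Word n = List (Fin n)

-- u ≤_w v : the (first) occurrence of u in w is at or before an
-- occurrence of v.  For words listing every vertex exactly once this is
-- exactly the total order ≤_w determined by w.
data Before {n} : Word n → Fin n → Fin n → Set where
  here  : ∀ {u v w} → v ∈ (u ∷ w) → Before (u ∷ w) u v
  there : ∀ {x u v w} → x ≢ u → Before w u v → Before (x ∷ w) u v

before? : ∀ {n} (w : Word n) (u v : Fin n) → Dec (Before w u v)
before? [] u v = no λ ()
before? {n} (x ∷ w) u v with x ≟F u
... | yes refl with DecMem._∈?_ (_≟F_ {n}) v (x ∷ w)
...   | yes p = yes (here p)
...   | no ¬p = no λ { (here p) → ¬p p ; (there x≢x _) → x≢x refl }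
before? (x ∷ w) u v | no x≢u with before? w u v
...   | yes b = yes (there x≢u b)
...   | no ¬b = no λ { (here _) → x≢u refl ; (there _ b) → ¬b b }

IsLinearExtension : ∀ {n} → Graph n → Word n → Set
IsLinearExtension {n} E w =
  Unique w × (∀ (v : Fin n) → v ∈ w) × All (λ e → Before w (α e) (ω e)) E

linExt? : ∀ {n} (E : Graph n) (w : Word n) → Dec (IsLinearExtension E w)
linExt? {n} E w =
  DecUniq.unique? (_≟F_ {n}) w
    ×-dec (allFin? (λ v → DecMem._∈?_ (_≟F_ {n}) v w)
    ×-dec all? (λ e → before? w (α e) (ω e)) E)

-- φ(G) = Σ_{w ∈ L(G)} w, an element of the free abelian group on words,
-- represented by its coefficient function: φ G w ∈ {0,1} is the
-- coefficient of the word w.  Two formal sums are equal iff all their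
-- coefficients agree.
φ : ∀ {n} → Graph n → Word n → ℤ
φ E w = if does (linExt? E w) then 1ℤ else 0ℤ

_∖_ : ∀ {n} → Graph n → List (Edge n) → Graph n
E ∖ E' = filter (λ e → ¬? (e ∈E? E')) E

-- Cycles.
-- A step of a cycle is an edge e ∈ E_G together with a direction:
-- true = traversed as e, false = traversed as ē.  The element e_i of the
-- cycle is the oriented pair `oriented s`.

Step : ℕ → Set
Step n = Edge n × Bool

oriented : ∀ {n} → Step n → Edge n
oriented (e , true)  = e
oriented (e , false) = rev e

underlying : ∀ {n} → Step n → Edge n
underlying = proj₁

rotate : ∀ {A : Set} → List A → List A
rotate [] = []
rotate (x ∷ xs) = xs ++ [ x ]

NonEmpty : ∀ {A : Set} → List A → Set
NonEmpty [] = Data.Empty.⊥ where import Data.Empty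
NonEmpty (_ ∷ _) = Data.Unit.⊤ where import Data.Unit

record IsCycle {n} (E : Graph n) (C : List (Step n)) : Set where
  field
    nonempty   : NonEmpty C
    inE        : All (λ s → underlying s ∈ E) C
    -- ω(e_i) = α(e_{i+1}) for i < k and ω(e_k) = α(e_1)
    closed     : map (λ s → ω (oriented s)) C ≡ rotate (map (λ s → α (oriented s)) C)
    distinctE  : Unique (map underlying C)
    distinctV  : Unique (map (λ s → α (oriented s)) C)

HE : ∀ {n} → Graph n → List (Step n) → List (Edge n)
HE E C = filter (λ e → e ∈E? E) (map oriented C)

subsets : ∀ {A : Set} → List A → List (List A)
subsets [] = [] ∷ []
subsets (x ∷ xs) = subsets xs ++ map (x ∷_) (subsets xs)

nonemptySubsets : ∀ {A : Set} → List A → List (List A)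
nonemptySubsets [] = []
nonemptySubsets (x ∷ xs) = nonemptySubsets xs ++ map (x ∷_) (subsets xs)

sumℤ : List ℤ → ℤ
sumℤ = foldr _+ℤ_ 0ℤ

φT : ∀ {n} → Graph n → List (Step n) → Word n → ℤ
φT E C w =
  sumℤ (map (λ E' → (-1ℤ ^ (length E' ∸ 1)) * φ (E ∖ E') w) (nonemptySubsets (HE E C)))

-- Both sides are compared coefficientwise, at a fixed word w.  Write
-- f(S) = φ(G∖S)(w) and H = HE(C).  A purely combinatorial identity about
-- signed sums over sublists turns the right-hand side into f(∅) - A, where
-- A = Σ_{S⊆H} (-1)^{|S|} f(S), so it remains to show A = 0.
--   * If some edge x ∈ H is satisfied by w (α x before ω x), then adding or
--     removing x does not change f, and the terms of A cancel in pairs.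
--   * Otherwise every edge of H is violated by w.  Then no graph G∖S with
--     S ⊆ H has w as linear extension: otherwise w would extend G∖H, every
--     step of the cycle would strictly decrease the position in w (edges of
--     H because they are violated, the remaining steps because they traverse
--     a satisfied edge backwards), and a closed walk cannot strictly descend.
--     Hence all terms of A vanish.
module Submission where

open import Defs
open import Function using (_∘_)
open import Data.Nat using (ℕ; suc; _∸_; _≤_; _<_; z≤n; s≤s)
import Data.Nat.Properties as ℕP
open import Data.Nat.ListAction using (sum)
open import Data.Nat.ListAction.Properties using (sum-↭)
open import Data.Fin using (Fin) renaming (_≟_ to _≟F_)
open import Data.Bool using (true; false; if_then_else_)
open import Data.Product using (_×_; _,_; proj₁)
open import Data.Sum using (inj₁; inj₂)
open import Data.Empty using (⊥-elim)
open import Data.List using (List; []; _∷_; _++_; [_]; map; length)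
import Data.List.Properties as LP
open import Data.List.Relation.Unary.All as All using (All)
open import Data.List.Relation.Unary.All.Properties using (anti-mono)
open import Data.List.Relation.Unary.Any as Any using (here; there; any?)
open import Data.List.Relation.Unary.AllPairs using (_∷_)
open import Data.List.Relation.Unary.Unique.Propositional using (Unique)
open import Data.List.Relation.Binary.Subset.Propositional using (_⊆_)
open import Data.List.Relation.Binary.Permutation.Propositional using (_↭_; ↭-sym)
import Data.List.Relation.Binary.Permutation.Propositional.Properties as ↭P
open import Data.List.Membership.Propositional using (_∈_; _∉_; find)
open import Data.List.Membership.Propositional.Properties
  using (∈-++⁺ˡ; ∈-++⁺ʳ; ∈-++⁻; ∈-map⁺; ∈-map⁻; ∈-filter⁺; ∈-filter⁻)
open import Data.Integer using (ℤ; 0ℤ; 1ℤ; -1ℤ; _*_; _^_; -_; _-_) renaming (_+_ to _+ℤ_)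
import Data.Integer.Properties as ℤP
open import Data.Integer.Tactic.RingSolver using (solve-∀)
open import Relation.Nullary using (Dec; yes; no; ¬_; ¬?; does)
open import Relation.Binary.PropositionalEquality
  using (_≡_; _≢_; refl; sym; trans; cong; cong₂; module ≡-Reasoning)
open ≡-Reasoning

sumOver : ∀ {A : Set} → List A → (A → ℤ) → ℤ
sumOver l F = sumℤ (map F l)

sumOver-++ : ∀ {A : Set} (l₁ l₂ : List A) (F : A → ℤ) →
             sumOver (l₁ ++ l₂) F ≡ sumOver l₁ F +ℤ sumOver l₂ F
sumOver-++ [] l₂ F = sym (ℤP.+-identityˡ _)
sumOver-++ (x ∷ l₁) l₂ F =
  trans (cong (F x +ℤ_) (sumOver-++ l₁ l₂ F)) (sym (ℤP.+-assoc (F x) _ _))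

sumOver-map : ∀ {A B : Set} (h : A → B) (l : List A) (F : B → ℤ) →
              sumOver (map h l) F ≡ sumOver l (F ∘ h)
sumOver-map h [] F = refl
sumOver-map h (x ∷ l) F = cong (F (h x) +ℤ_) (sumOver-map h l F)

sumOver-cong : ∀ {A : Set} (l : List A) {F G : A → ℤ} →
               (∀ x → F x ≡ G x) → sumOver l F ≡ sumOver l G
sumOver-cong [] F≗G = refl
sumOver-cong (x ∷ l) F≗G = cong₂ _+ℤ_ (F≗G x) (sumOver-cong l F≗G)

sumOver-neg : ∀ {A : Set} (l : List A) (F : A → ℤ) →
              sumOver l (λ x → - F x) ≡ - sumOver l F
sumOver-neg [] F = refl
sumOver-neg (x ∷ l) F =
  trans (cong (- F x +ℤ_) (sumOver-neg l F)) (sym (ℤP.neg-distrib-+ (F x) _))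

sumOver-zero : ∀ {A : Set} (l : List A) (F : A → ℤ) →
               (∀ x → x ∈ l → F x ≡ 0ℤ) → sumOver l F ≡ 0ℤ
sumOver-zero [] F F≡0 = refl
sumOver-zero (x ∷ l) F F≡0 =
  cong₂ _+ℤ_ (F≡0 x (here refl)) (sumOver-zero l F (λ y y∈l → F≡0 y (there y∈l)))

-- The prefix X records the elements already added; it is what makes the
-- recursion on H go through.

signedSum : ∀ {A : Set} → (List A → ℤ) → List A → List A → ℤ
signedSum f X H = sumOver (subsets H) (λ S → (-1ℤ ^ length S) * f (X ++ S))

signedSum-∷ : ∀ {A : Set} (f : List A → ℤ) X x xs →
              signedSum f X (x ∷ xs) ≡ signedSum f X xs - signedSum f (X ++ [ x ]) xs
signedSum-∷ f X x xs = begin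
    sumOver (subsets xs ++ map (x ∷_) (subsets xs)) term
  ≡⟨ sumOver-++ (subsets xs) _ term ⟩
    signedSum f X xs +ℤ sumOver (map (x ∷_) (subsets xs)) term
  ≡⟨ cong (signedSum f X xs +ℤ_) (sumOver-map (x ∷_) (subsets xs) term) ⟩
    signedSum f X xs +ℤ sumOver (subsets xs) (term ∘ (x ∷_))
  ≡⟨ cong (signedSum f X xs +ℤ_) (sumOver-cong (subsets xs) choose-x) ⟩
    signedSum f X xs +ℤ sumOver (subsets xs) (λ S → - term′ S)
  ≡⟨ cong (signedSum f X xs +ℤ_) (sumOver-neg (subsets xs) term′) ⟩
    signedSum f X xs - signedSum f (X ++ [ x ]) xs
  ∎
  where
    term term′ : _ → ℤ
    term S = (-1ℤ ^ length S) * f (X ++ S)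
    term′ S = (-1ℤ ^ length S) * f ((X ++ [ x ]) ++ S)

    sign-flip : ∀ p v → (-1ℤ * p) * v ≡ - (p * v)
    sign-flip = solve-∀

    choose-x : ∀ S → term (x ∷ S) ≡ - term′ S
    choose-x S = trans (cong (λ L → (-1ℤ * (-1ℤ ^ length S)) * f L) (sym (LP.++-assoc X [ x ] S)))
                       (sign-flip (-1ℤ ^ length S) (f ((X ++ [ x ]) ++ S)))

nonemptySum≡ : ∀ {A : Set} (f : List A → ℤ) (H : List A) →
               sumOver (nonemptySubsets H) (λ S → (-1ℤ ^ (length S ∸ 1)) * f S)
                 ≡ f [] - signedSum f [] H
nonemptySum≡ f [] = sym (cancel (f []))
  where
    cancel : ∀ v → v - (1ℤ * v +ℤ 0ℤ) ≡ 0ℤ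
    cancel = solve-∀
nonemptySum≡ f (x ∷ xs) = begin
    sumOver (nonemptySubsets xs ++ map (x ∷_) (subsets xs)) term
  ≡⟨ sumOver-++ (nonemptySubsets xs) _ term ⟩
    sumOver (nonemptySubsets xs) term +ℤ sumOver (map (x ∷_) (subsets xs)) term
  ≡⟨ cong₂ _+ℤ_ (nonemptySum≡ f xs) (sumOver-map (x ∷_) (subsets xs) term) ⟩
    (f [] - signedSum f [] xs) +ℤ signedSum f [ x ] xs
  ≡⟨ regroup (f []) (signedSum f [] xs) (signedSum f [ x ] xs) ⟩
    f [] - (signedSum f [] xs - signedSum f [ x ] xs)
  ≡⟨ cong (λ t → f [] - t) (sym (signedSum-∷ f [] x xs)) ⟩
    f [] - signedSum f [] (x ∷ xs)
  ∎
  where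
    term : _ → ℤ
    term S = (-1ℤ ^ (length S ∸ 1)) * f S

    regroup : ∀ v a b → (v - a) +ℤ b ≡ v - (a - b)
    regroup = solve-∀

subsets-⊆ : ∀ {A : Set} (H : List A) {S} → S ∈ subsets H → S ⊆ H
subsets-⊆ [] (here refl) ()
subsets-⊆ (x ∷ xs) S∈ y∈S with ∈-++⁻ (subsets xs) S∈
... | inj₁ S∈′ = there (subsets-⊆ xs S∈′ y∈S)
... | inj₂ S∈′ with ∈-map⁻ (x ∷_) S∈′
...   | T , T∈ , refl with y∈S
...     | here refl = here refl
...     | there y∈T = there (subsets-⊆ xs T∈ y∈T)

signedSum-vanishes : ∀ {A : Set} (f : List A → ℤ) X H →
                     (∀ S → S ⊆ H → f (X ++ S) ≡ 0ℤ) → signedSum f X H ≡ 0ℤ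
signedSum-vanishes f X H f≡0 = sumOver-zero (subsets H) _ λ S S∈ →
  trans (cong ((-1ℤ ^ length S) *_) (f≡0 S (subsets-⊆ H S∈))) (ℤP.*-zeroʳ (-1ℤ ^ length S))

-- If f depends only on the set of elements of its argument and adding x
-- never changes it, then the terms with and without x cancel in pairs.
signedSum-cancels : ∀ {A : Set} (f : List A → ℤ) {x : A} →
                    (∀ {L L′} → L ⊆ L′ → L′ ⊆ L → f L ≡ f L′) →
                    (∀ L → f (x ∷ L) ≡ f L) →
                    ∀ X H → x ∈ H → signedSum f X H ≡ 0ℤ
signedSum-cancels f {x} setwise absorbs X (.x ∷ xs) (here refl) = begin
    signedSum f X (x ∷ xs)
  ≡⟨ signedSum-∷ f X x xs ⟩
    signedSum f X xs - signedSum f (X ++ [ x ]) xs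
  ≡⟨ cong (λ t → signedSum f X xs - t) (sumOver-cong (subsets xs) drop-x) ⟩
    signedSum f X xs - signedSum f X xs
  ≡⟨ ℤP.+-inverseʳ (signedSum f X xs) ⟩
    0ℤ
  ∎
  where
    rotate-x : ∀ S → (X ++ [ x ]) ++ S ⊆ x ∷ (X ++ S)
    rotate-x S y∈ with ∈-++⁻ (X ++ [ x ]) y∈
    ... | inj₂ y∈S = there (∈-++⁺ʳ X y∈S)
    ... | inj₁ y∈Xx with ∈-++⁻ X y∈Xx
    ...   | inj₁ y∈X = there (∈-++⁺ˡ y∈X)
    ...   | inj₂ (here refl) = here refl

    unrotate-x : ∀ S → x ∷ (X ++ S) ⊆ (X ++ [ x ]) ++ S
    unrotate-x S (here refl) = ∈-++⁺ˡ (∈-++⁺ʳ X (here refl))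
    unrotate-x S (there y∈) with ∈-++⁻ X y∈
    ... | inj₁ y∈X = ∈-++⁺ˡ (∈-++⁺ˡ y∈X)
    ... | inj₂ y∈S = ∈-++⁺ʳ (X ++ [ x ]) y∈S

    drop-x : ∀ S → (-1ℤ ^ length S) * f ((X ++ [ x ]) ++ S) ≡ (-1ℤ ^ length S) * f (X ++ S)
    drop-x S = cong ((-1ℤ ^ length S) *_)
      (trans (setwise (rotate-x S) (unrotate-x S)) (absorbs (X ++ S)))
signedSum-cancels f setwise absorbs X (y ∷ xs) (there x∈xs) = begin
    signedSum f X (y ∷ xs)
  ≡⟨ signedSum-∷ f X y xs ⟩
    signedSum f X xs - signedSum f (X ++ [ y ]) xs
  ≡⟨ cong₂ _-_ (signedSum-cancels f setwise absorbs X xs x∈xs)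
               (signedSum-cancels f setwise absorbs (X ++ [ y ]) xs x∈xs) ⟩
    0ℤ
  ∎

sum-mono-≤ : ∀ {A : Set} (f g : A → ℕ) (l : List A) →
             (∀ x → x ∈ l → f x < g x) → sum (map f l) ≤ sum (map g l)
sum-mono-≤ f g [] f<g = z≤n
sum-mono-≤ f g (x ∷ l) f<g =
  ℕP.+-mono-≤ (ℕP.<⇒≤ (f<g x (here refl))) (sum-mono-≤ f g l (λ y y∈ → f<g y (there y∈)))

sum-mono-< : ∀ {A : Set} (f g : A → ℕ) (l : List A) → NonEmpty l →
             (∀ x → x ∈ l → f x < g x) → sum (map f l) < sum (map g l)
sum-mono-< f g (x ∷ l) _ f<g =
  ℕP.+-mono-<-≤ (f<g x (here refl)) (sum-mono-≤ f g l (λ y y∈ → f<g y (there y∈)))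

rotate-↭ : ∀ {A : Set} (l : List A) → rotate l ↭ l
rotate-↭ [] = ↭-sym (↭P.++-identityʳ [])
rotate-↭ (x ∷ xs) = ↭P.++-comm xs [ x ]

-- A closed walk (each step ends where the next one starts, cyclically)
-- cannot strictly decrease a ℕ-valued potential at every step: the sums of
-- the potential over the starting and over the ending points coincide.
no-descending-closed-walk :
  ∀ {A B : Set} (pot : B → ℕ) (src tgt : A → B) (l : List A) → NonEmpty l →
  map tgt l ≡ rotate (map src l) → ¬ (∀ x → x ∈ l → pot (tgt x) < pot (src x))
no-descending-closed-walk pot src tgt l l≢[] closed descends =
  ℕP.<-irrefl same-sum (sum-mono-< (pot ∘ tgt) (pot ∘ src) l l≢[] descends)
  where
    same-sum : sum (map (pot ∘ tgt) l) ≡ sum (map (pot ∘ src) l)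
    same-sum = begin
        sum (map (pot ∘ tgt) l)
      ≡⟨ cong sum (LP.map-∘ l) ⟩
        sum (map pot (map tgt l))
      ≡⟨ cong (sum ∘ map pot) closed ⟩
        sum (map pot (rotate (map src l)))
      ≡⟨ sum-↭ (↭P.map⁺ pot (rotate-↭ (map src l))) ⟩
        sum (map pot (map src l))
      ≡⟨ cong sum (sym (LP.map-∘ l)) ⟩
        sum (map (pot ∘ src) l)
      ∎

module _ {n : ℕ} where

  position : Word n → Fin n → ℕ
  position [] v = 0
  position (x ∷ w) v with x ≟F v
  ... | yes _ = 0
  ... | no _ = suc (position w v)

  Before⇒∈ : ∀ {w : Word n} {u v} → Before w u v → v ∈ w
  Before⇒∈ (here v∈) = v∈
  Before⇒∈ (there _ b) = there (Before⇒∈ b)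

  ∈-tail : ∀ {x u : Fin n} {w} → x ≢ u → u ∈ x ∷ w → u ∈ w
  ∈-tail x≢u (here refl) = ⊥-elim (x≢u refl)
  ∈-tail x≢u (there u∈) = u∈

  Before⇒position≤ : ∀ {w : Word n} {u v} → Unique w → Before w u v →
                     position w u ≤ position w v
  Before⇒position≤ {u ∷ w} {.u} _ (here _) with u ≟F u
  ... | yes _ = z≤n
  ... | no u≢u = ⊥-elim (u≢u refl)
  Before⇒position≤ {x ∷ w} {u} {v} (x∉w ∷ uw) (there x≢u b) with x ≟F u | x ≟F v
  ... | yes x≡u | _ = ⊥-elim (x≢u x≡u)
  ... | no _ | yes refl = ⊥-elim (All.lookup x∉w (Before⇒∈ b) refl)
  ... | no _ | no _ = s≤s (Before⇒position≤ uw b)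

  position≤⇒Before : ∀ {w : Word n} {u v} → u ∈ w → v ∈ w →
                     position w u ≤ position w v → Before w u v
  position≤⇒Before {x ∷ w} {u} {v} u∈ v∈ ≤pos with x ≟F u | x ≟F v
  ... | yes refl | _ = here v∈
  ... | no x≢u | yes refl with ≤pos
  ...   | ()
  position≤⇒Before {x ∷ w} u∈ v∈ (s≤s ≤pos) | no x≢u | no x≢v =
    there x≢u (position≤⇒Before (∈-tail x≢u u∈) (∈-tail x≢v v∈) ≤pos)

  position-injective : ∀ {w : Word n} {u v} → u ∈ w → v ∈ w →
                       position w u ≡ position w v → u ≡ v
  position-injective {x ∷ w} {u} {v} u∈ v∈ eq with x ≟F u | x ≟F v
  ... | yes refl | yes refl = refl
  ... | yes refl | no _ = ⊥-elim (ℕP.0≢1+n eq)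
  ... | no _ | yes refl = ⊥-elim (ℕP.0≢1+n (sym eq))
  ... | no x≢u | no x≢v =
    position-injective (∈-tail x≢u u∈) (∈-tail x≢v v∈) (ℕP.suc-injective eq)

  ¬Before⇒position> : ∀ {w : Word n} {u v} → u ∈ w → v ∈ w →
                      ¬ Before w u v → position w v < position w u
  ¬Before⇒position> u∈ v∈ ¬b = ℕP.≰⇒> (¬b ∘ position≤⇒Before u∈ v∈)

  Before⇒position< : ∀ {w : Word n} {u v} → Unique w → u ∈ w → v ∈ w →
                     Before w u v → u ≢ v → position w u < position w v
  Before⇒position< uw u∈ v∈ b u≢v =
    ℕP.≤∧≢⇒< (Before⇒position≤ uw b) (u≢v ∘ position-injective u∈ v∈)

Sat : ∀ {n} → Word n → Edge n → Set
Sat w e = Before w (α e) (ω e)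

indicator : ∀ {P : Set} → Dec P → ℤ
indicator p = if does p then 1ℤ else 0ℤ

indicator-cong : ∀ {P Q : Set} (p : Dec P) (q : Dec Q) → (P → Q) → (Q → P) →
                 indicator p ≡ indicator q
indicator-cong (yes _) (yes _) P⇒Q Q⇒P = refl
indicator-cong (no _) (no _) P⇒Q Q⇒P = refl
indicator-cong (yes p) (no ¬q) P⇒Q Q⇒P = ⊥-elim (¬q (P⇒Q p))
indicator-cong (no ¬p) (yes q) P⇒Q Q⇒P = ⊥-elim (¬p (Q⇒P q))

indicator-no : ∀ {P : Set} (p : Dec P) → ¬ P → indicator p ≡ 0ℤ
indicator-no (yes p) ¬p = ⊥-elim (¬p p)
indicator-no (no _) ¬p = refl

φ-cong : ∀ {n} {F F′ : Graph n} (w : Word n) →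
         (All (Sat w) F → All (Sat w) F′) → (All (Sat w) F′ → All (Sat w) F) →
         φ F w ≡ φ F′ w
φ-cong {F = F} {F′} w F⇒F′ F′⇒F = indicator-cong (linExt? F w) (linExt? F′ w)
  (λ (uw , cover , sat) → uw , cover , F⇒F′ sat)
  (λ (uw , cover , sat) → uw , cover , F′⇒F sat)

φ-zero : ∀ {n} (F : Graph n) (w : Word n) → ¬ IsLinearExtension F w → φ F w ≡ 0ℤ
φ-zero F w = indicator-no (linExt? F w)

∖-[] : ∀ {n} (E : Graph n) → E ∖ [] ≡ E
∖-[] [] = refl
∖-[] (e ∷ E) = cong (e ∷_) (∖-[] E)

∈-∖⁺ : ∀ {n} {E L : Graph n} {e} → e ∈ E → e ∉ L → e ∈ E ∖ L
∈-∖⁺ {L = L} e∈E e∉L = ∈-filter⁺ (λ e → ¬? (e ∈E? L)) e∈E e∉L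

∈-∖⁻ : ∀ {n} {E L : Graph n} {e} → e ∈ E ∖ L → e ∈ E × e ∉ L
∈-∖⁻ {L = L} = ∈-filter⁻ (λ e → ¬? (e ∈E? L))

∖-anti : ∀ {n} (E : Graph n) {L L′ : Graph n} → L ⊆ L′ → E ∖ L′ ⊆ E ∖ L
∖-anti E {L} {L′} L⊆L′ e∈ =
  let e∈E , e∉L′ = ∈-∖⁻ {E = E} {L′} e∈ in ∈-∖⁺ {E = E} {L} e∈E (e∉L′ ∘ L⊆L′)

φ-∖-setwise : ∀ {n} (E : Graph n) (w : Word n) {L L′ : Graph n} →
              L ⊆ L′ → L′ ⊆ L → φ (E ∖ L) w ≡ φ (E ∖ L′) w
φ-∖-setwise E w L⊆L′ L′⊆L =
  φ-cong w (anti-mono (∖-anti E L⊆L′)) (anti-mono (∖-anti E L′⊆L))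

φ-∖-absorbs : ∀ {n} (E : Graph n) (w : Word n) {x} → Sat w x →
              ∀ L → φ (E ∖ (x ∷ L)) w ≡ φ (E ∖ L) w
φ-∖-absorbs E w {x} sat-x L =
  φ-cong w (λ sat → All.tabulate (restore sat)) (anti-mono (∖-anti E there))
  where
    restore : All (Sat w) (E ∖ (x ∷ L)) → ∀ {e} → e ∈ E ∖ L → Sat w e
    restore sat {e} e∈ with e ≟E x
    ... | yes refl = sat-x
    ... | no e≢x = let e∈E , e∉L = ∈-∖⁻ {E = E} {L} e∈ in
      All.lookup sat (∈-∖⁺ {E = E} {x ∷ L} e∈E λ { (here e≡x) → e≢x e≡x ; (there e∈L) → e∉L e∈L })

map-unique⇒injective : ∀ {A B : Set} (f : A → B) {xs : List A} {x y} →
                       Unique (map f xs) → x ∈ xs → y ∈ xs → f x ≡ f y → x ≡ y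
map-unique⇒injective f {_ ∷ _} _ (here refl) (here refl) _ = refl
map-unique⇒injective f {_ ∷ _} (fz∉ ∷ _) (here refl) (there y∈) eq =
  ⊥-elim (All.lookup fz∉ (∈-map⁺ f y∈) eq)
map-unique⇒injective f {_ ∷ _} (fz∉ ∷ _) (there x∈) (here refl) eq =
  ⊥-elim (All.lookup fz∉ (∈-map⁺ f x∈) (sym eq))
map-unique⇒injective f {_ ∷ _} (_ ∷ u) (there x∈) (there y∈) eq =
  map-unique⇒injective f u x∈ y∈ eq

module _ {n : ℕ} {E : Graph n} {C : List (Step n)} (cycle : IsCycle E C) where
  open IsCycle cycle

  -- An edge traversed backwards, whose reverse is not an edge, is not in HE(C):
  -- it occurs only once on the cycle.
  backward-∉HE : ∀ {e} → (e , false) ∈ C → rev e ∉ E → e ∉ HE E C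
  backward-∉HE {e} s∈C rev-e∉E e∈HE
    with ∈-map⁻ oriented (proj₁ (∈-filter⁻ (_∈E? E) e∈HE))
  ... | (e′ , false) , t∈C , refl = rev-e∉E (All.lookup inE t∈C)
  ... | (e′ , true) , t∈C , refl
    with map-unique⇒injective underlying distinctE t∈C s∈C refl
  ...   | ()

  cycle-satisfies-some : ∀ {w : Word n} → IsLinearExtension (E ∖ HE E C) w →
                         ¬ (∀ x → x ∈ HE E C → ¬ Sat w x)
  cycle-satisfies-some {w} (uw , cover , sat) violated =
    no-descending-closed-walk (position w) (α ∘ oriented) (ω ∘ oriented) C
      nonempty closed descends
    where
      pos : Fin n → ℕ
      pos = position w

      -- a step along an edge of HE(C) goes against the violated edge; any
      -- other step traverses backwards an edge of G∖HE(C), which w satisfies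
      descends : ∀ s → s ∈ C → pos (ω (oriented s)) < pos (α (oriented s))
      descends s s∈C with oriented s ∈E? E
      ... | yes o∈E =
        ¬Before⇒position> (cover _) (cover _)
          (violated _ (∈-filter⁺ (_∈E? E) (∈-map⁺ oriented s∈C) o∈E))
      descends (e , true) s∈C | no e∉E = ⊥-elim (e∉E (All.lookup inE s∈C))
      descends ((a , b) , false) s∈C | no rev-e∉E =
        Before⇒position< uw (cover a) (cover b)
          (All.lookup sat (∈-∖⁺ e∈E (backward-∉HE s∈C rev-e∉E)))
          (λ { refl → rev-e∉E e∈E })
        where
          e∈E : (a , b) ∈ E
          e∈E = All.lookup inE s∈C

  cycle-signedSum-vanishes : ∀ (w : Word n) →
                             signedSum (λ S → φ (E ∖ S) w) [] (HE E C) ≡ 0ℤ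
  cycle-signedSum-vanishes w with any? (λ e → before? w (α e) (ω e)) (HE E C)
  ... | yes some-sat =
    let x , x∈HE , sat-x = find some-sat in
    signedSum-cancels (λ S → φ (E ∖ S) w) (φ-∖-setwise E w) (φ-∖-absorbs E w sat-x)
      [] (HE E C) x∈HE
  ... | no none-sat =
    signedSum-vanishes (λ S → φ (E ∖ S) w) [] (HE E C) λ S S⊆HE →
      φ-zero (E ∖ S) w λ (uw , cover , sat) →
        cycle-satisfies-some (uw , cover , anti-mono (∖-anti E S⊆HE) sat)
          λ x x∈HE sat-x → none-sat (Any.map (λ { refl → sat-x }) x∈HE)

mainTheorem1 : (n : ℕ) (E : Graph n) → Unique E →
    (C : List (Step n)) → IsCycle E C →
    (w : Word n) → φ E w ≡ φT E C w
mainTheorem1 n E _ C cycle w = begin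
    φ E w
  ≡⟨ cong (λ F → φ F w) (sym (∖-[] E)) ⟩
    f []
  ≡⟨ sym (ℤP.+-identityʳ (f [])) ⟩
    f [] - 0ℤ
  ≡⟨ cong (λ t → f [] - t) (sym (cycle-signedSum-vanishes cycle w)) ⟩
    f [] - signedSum f [] (HE E C)
  ≡⟨ sym (nonemptySum≡ f (HE E C)) ⟩
    φT E C w
  ∎
  where
    f : List (Edge n) → ℤ
    f S = φ (E ∖ S) w
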